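{- Let $\Psi$ be a bipartite property and let $\mathbf{H}$ be a bipartite graph. For every bipartite graph $\mathbf{G}$ with consistent $\mathbf{H}$-colouring $c$, \[\#\mathrm{BipIndSub}_c(\Psi,\mathbf{G}) = \sum_{T\subseteq E(H)} a_T \cdot \#\mathrm{Hom}_c(H[T],G)\,,\] where $G$ and $H$ are the underlying graphs of $\mathbf{G}$ and $\mathbf{H}$, and $a_T=\sum_{A\subseteq T}\Psi(\mathbf{H}[A])\cdot(-1)^{|T|-|A|}$.
   Context: A bipartite graph is $\mathbf{G}=(V_1,V_2,E)$ with ordered bipartition, underlying graph $(V_1\cup V_2,E)$. A bipartite property is a function from bipartite graphs to $\{0,1\}$ invariant under consistent isomorphisms (isomorphisms preserving each of the two parts). A consistent $\mathbf{H}$-colouring of $\mathbf{G}$ is a homomorphism $c$ of underlying graphs with $c(V_i(\mathbf{G}))\subseteq V_i(\mathbf{H})$, $i=1,2$. $\mathbf{G}[S]=(V_1\cap S,V_2\cap S,E')$ with $E'$ the edges inside $S$; $\mathbf{H}[A]=(V_1(\mathbf{H}),V_2(\mathbf{H}),A)$ and $H[A]=(V(H),A)$ for $A\subseteq E(H)$. $\mathrm{BipIndSub}_c(\Psi,\mathbf{G})$ is the set of all $S\subseteq V(\mathbf{G})$ with $|S|=|V(\mathbf{H})|$, $c(S)=V(\mathbf{H})$ and $\Psi(\mathbf{G}[S])=1$. $\mathrm{Hom}_c(H[T],G)$ is the set of homomorphisms $\varphi$ from $H[T]$ to $G$ that are $c$-colour-prescribed, i.e. $c(\varphi(v))=v$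 for all $v\in V(H)$. -}

module Defs where

open import Data.Bool using (Bool; true; false; _∧_; _∨_; not; if_then_else_)
open import Data.Nat using (ℕ; zero; suc; _+_; _∸_)
open import Data.Integer using (ℤ; +_; -_; _*_) renaming (_+_ to _+ℤ_; _^_ to _^ℤ_)
open import Data.Fin using (Fin; zero; suc)
open import Data.List using (List; []; _∷_; map; concatMap; filterᵇ; length; lookup; foldr; _++_; allFin)
open import Data.Bool.ListAction using (and; or)
open import Data.Nat.ListAction using (sum)
open import Data.Sum using (_⊎_; inj₁; inj₂; [_,_])
open import Data.Product using (_×_; _,_; Σ)
open import Function.Bundles using (_⤖_; Bijection)
open import Relation.Binary.PropositionalEquality using (_≡_)
open import Relation.Nullary.Decidable using (⌊_⌋)
open import Data.Fin using (_≟_)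
open import Data.Nat using (_≡ᵇ_)

finCases : {A : Set} {n : ℕ} → A → (Fin n → A) → Fin (suc n) → A
finCases a f zero    = a
finCases a f (suc i) = f i

allFuns : {A : Set} → (n : ℕ) → List A → List (Fin n → A)
allFuns zero    xs = (λ ()) ∷ []
allFuns (suc n) xs = concatMap (λ a → map (λ f → finCases a f) (allFuns n xs)) xs

bools : List Bool
bools = true ∷ false ∷ []

allSubsets : (n : ℕ) → List (Fin n → Bool)
allSubsets n = allFuns n bools

count : {A : Set} → (A → Bool) → List A → ℕ
count p xs = length (filterᵇ p xs)

sumℤ : {A : Set} → (A → ℤ) → List A → ℤ
sumℤ f xs = foldr (λ x acc → f x +ℤ acc) (+ 0) xs

_⇒ᵇ_ : Bool → Bool → Bool
a ⇒ᵇ b = not a ∨ b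

card : {n : ℕ} → (Fin n → Bool) → ℕ
card {n} S = count S (allFin n)

-- Bipartite graphs with ordered bipartition (V₁ , V₂).
-- V₁ = Fin n₁, V₂ = Fin n₂ (disjoint); edges only between V₁ and V₂,
-- given by the adjacency E i j for i ∈ V₁, j ∈ V₂.

record BipGraph : Set where
  constructor bip
  field
    n₁ : ℕ
    n₂ : ℕ
    E  : Fin n₁ → Fin n₂ → Bool
open BipGraph public

V : BipGraph → Set
V G = Fin (n₁ G) ⊎ Fin (n₂ G)

allV : (G : BipGraph) → List (V G)
allV G = map inj₁ (allFin (n₁ G)) ++ map inj₂ (allFin (n₂ G))

adj : (G : BipGraph) → V G → V G → Bool
adj G (inj₁ i) (inj₁ i′) = false
adj G (inj₁ i) (inj₂ j)  = E G i j
adj G (inj₂ j) (inj₁ i)  = E G i j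
adj G (inj₂ j) (inj₂ j′) = false

record ConsIso (G G′ : BipGraph) : Set where
  field
    σ₁ : Fin (n₁ G) ⤖ Fin (n₁ G′)
    σ₂ : Fin (n₂ G) ⤖ Fin (n₂ G′)
    pres : ∀ i j → E G i j ≡ E G′ (Bijection.to σ₁ i) (Bijection.to σ₂ j)

BipProperty : Set
BipProperty = BipGraph → Bool

IsBipProperty : BipProperty → Set
IsBipProperty Ψ = ∀ G G′ → ConsIso G G′ → Ψ G ≡ Ψ G′

Ψℤ : BipProperty → BipGraph → ℤ
Ψℤ Ψ G = if Ψ G then + 1 else + 0

IsHom : (H G : BipGraph) → (V H → V G) → Set
IsHom H G φ = ∀ u v → adj H u v ≡ true → adj G (φ u) (φ v) ≡ true

SidePreserving : (G H : BipGraph) → (V G → V H) → Set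
SidePreserving G H c =
  (∀ i → Σ (Fin (n₁ H)) λ i′ → c (inj₁ i) ≡ inj₁ i′) ×
  (∀ j → Σ (Fin (n₂ H)) λ j′ → c (inj₂ j) ≡ inj₂ j′)

ConsistentColouring : (G H : BipGraph) → (V G → V H) → Set
ConsistentColouring G H c = IsHom G H c × SidePreserving G H c

-- Induced bipartite subgraph G[S], S = (S₁ ⊆ V₁ , S₂ ⊆ V₂)
-- (vertices of S₁, S₂ re-indexed in increasing order; well defined up to
-- consistent isomorphism, which is all a bipartite property sees)

elems : {n : ℕ} → (Fin n → Bool) → List (Fin n)
elems {n} S = filterᵇ S (allFin n)

induced : (G : BipGraph) → (Fin (n₁ G) → Bool) → (Fin (n₂ G) → Bool) → BipGraph
induced G S₁ S₂ = bip (length (elems S₁)) (length (elems S₂))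
  (λ i j → E G (lookup (elems S₁) i) (lookup (elems S₂) j))

VSub : BipGraph → Set
VSub G = (Fin (n₁ G) → Bool) × (Fin (n₂ G) → Bool)

allVSub : (G : BipGraph) → List (VSub G)
allVSub G = concatMap (λ S₁ → map (λ S₂ → S₁ , S₂) (allSubsets (n₂ G))) (allSubsets (n₁ G))

inVSub : (G : BipGraph) → VSub G → V G → Bool
inVSub G (S₁ , S₂) (inj₁ i) = S₁ i
inVSub G (S₁ , S₂) (inj₂ j) = S₂ j


eqVᵇ : (H : BipGraph) → V H → V H → Bool
eqVᵇ H (inj₁ i) (inj₁ i′) = ⌊ i ≟ i′ ⌋
eqVᵇ H (inj₁ i) (inj₂ j′) = false
eqVᵇ H (inj₂ j) (inj₁ i′) = false
eqVᵇ H (inj₂ j) (inj₂ j′) = ⌊ j ≟ j′ ⌋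

allᵇ : {A : Set} → List A → (A → Bool) → Bool
allᵇ xs p = and (map p xs)

anyᵇ : {A : Set} → List A → (A → Bool) → Bool
anyᵇ xs p = or (map p xs)

isBipIndSubᵇ : (Ψ : BipProperty) (G H : BipGraph) (c : V G → V H) → VSub G → Bool
isBipIndSubᵇ Ψ G H c S =
  ((card (Data.Product.proj₁ S) + card (Data.Product.proj₂ S)) ≡ᵇ (n₁ H + n₂ H))
  ∧ allᵇ (allV H) (λ w → anyᵇ (allV G) (λ v → inVSub G S v ∧ eqVᵇ H (c v) w))
  ∧ Ψ (induced G (Data.Product.proj₁ S) (Data.Product.proj₂ S))

#BipIndSub : (Ψ : BipProperty) (G H : BipGraph) (c : V G → V H) → ℕ
#BipIndSub Ψ G H c = count (isBipIndSubᵇ Ψ G H c) (allVSub G)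

EdgeSet : BipGraph → Set
EdgeSet H = Fin (n₁ H) → Fin (n₂ H) → Bool

allEdgeSets : (H : BipGraph) → List (EdgeSet H)
allEdgeSets H = allFuns (n₁ H) (allSubsets (n₂ H))

_⊆ᵇ_ : {H : BipGraph} → EdgeSet H → EdgeSet H → Bool
_⊆ᵇ_ {H} A T = allᵇ (allFin (n₁ H)) (λ i → allᵇ (allFin (n₂ H)) (λ j → A i j ⇒ᵇ T i j))

subsetsOf : (H : BipGraph) → EdgeSet H → List (EdgeSet H)
subsetsOf H T = filterᵇ (λ A → _⊆ᵇ_ {H} A T) (allEdgeSets H)

#edges : (H : BipGraph) → EdgeSet H → ℕ
#edges H A = sum (map (λ i → card (A i)) (allFin (n₁ H)))

-- 𝐇[A] = (V₁(H), V₂(H), A); its underlying graph is H[A] = (V(H), A)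
_[_]ᴱ : (H : BipGraph) → EdgeSet H → BipGraph
H [ A ]ᴱ = bip (n₁ H) (n₂ H) A

coeff : (Ψ : BipProperty) (H : BipGraph) → EdgeSet H → ℤ
coeff Ψ H T = sumℤ (λ A → Ψℤ Ψ (H [ A ]ᴱ) * ((- (+ 1)) ^ℤ (#edges H T ∸ #edges H A)))
                   (subsetsOf H T)

allMaps : (H G : BipGraph) → List (V H → V G)
allMaps H G = concatMap (λ f₁ → map (λ f₂ → [ f₁ , f₂ ]) (allFuns (n₂ H) (allV G)))
                        (allFuns (n₁ H) (allV G))

isHomᵇ : (H G : BipGraph) → (V H → V G) → Bool
isHomᵇ H G φ = allᵇ (allV H) (λ u → allᵇ (allV H) (λ v → adj H u v ⇒ᵇ adj G (φ u) (φ v)))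

isColPrescribedᵇ : (G H : BipGraph) (c : V G → V H) → (V H → V G) → Bool
isColPrescribedᵇ G H c φ = allᵇ (allV H) (λ v → eqVᵇ H (c (φ v)) v)

#Hom-c : (H G : BipGraph) (c : V G → V H) → EdgeSet H → ℕ
#Hom-c H G c T = count (λ φ → isHomᵇ (H [ T ]ᴱ) G φ ∧ isColPrescribedᵇ G H c φ) (allMaps H G)

{-# OPTIONS --safe #-}
module Submission where

open import Defs

open import Data.Bool using (Bool; true; false; _∧_; _∨_; if_then_else_)
import Data.Bool.Properties as Bool
open import Data.Empty using (⊥-elim)
open import Data.Fin using (Fin; zero; suc)
import Data.Fin as Fin
open import Data.Fin.Properties using (all?)
open import Data.Integer as ℤ using (ℤ; +_; -_; _*_; _^_) renaming (_+_ to _+ℤ_)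
import Data.Integer.Properties as ℤ
open import Data.Integer.Solver using (module +-*-Solver)
open import Data.List using (List; []; _∷_; map; concatMap; filterᵇ; length; _++_; allFin; tabulate; lookup)
open import Data.List.Membership.Propositional using (_∈_)
open import Data.List.Membership.Propositional.Properties
  using (∈-allFin; ∈-map⁺; ∈-map⁻; ∈-++⁺ˡ; ∈-++⁺ʳ; ∈-lookup; ∈-filter⁺; ∈-filter⁻)
open import Data.List.Properties using (length-++; length-map; length-tabulate)
open import Data.List.Relation.Unary.All using (All; []; _∷_)
import Data.List.Relation.Unary.All as All
open import Data.List.Relation.Unary.AllPairs using ([]; _∷_)
open import Data.List.Relation.Unary.Any using (here; there)
import Data.List.Relation.Unary.Any as Any
open import Data.List.Relation.Unary.Any.Properties using (lookup-index)
open import Data.List.Relation.Unary.Unique.Propositional using (Unique)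
import Data.List.Relation.Unary.Unique.Propositional.Properties as Unique
open import Data.Nat as ℕ using (ℕ; zero; suc; _∸_; _≤_; z≤n; s≤s)
open import Data.Nat.ListAction using (sum)
import Data.Nat.Properties as ℕ
open import Data.Product using (_×_; _,_; proj₁; proj₂; ∃-syntax)
open import Data.Sum using (inj₁; inj₂; [_,_])
open import Data.Sum.Properties using (inj₁-injective; inj₂-injective; ≡-dec)
open import Data.Vec.Functional.Relation.Binary.Pointwise using (Pointwise)
open import Function using (_∘_; case_of_)
open import Function.Bundles using (_⤖_; mk⤖; mk⇔; Equivalence)
open import Function.Construct.Identity using (⤖-id)
open import Relation.Binary.Definitions using (DecidableEquality; Decidable)
open import Relation.Binary.PropositionalEquality
  using (_≡_; _≢_; _≗_; refl; sym; trans; cong; cong₂; subst; subst₂; module ≡-Reasoning)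
open import Relation.Nullary using (¬_; Dec; yes; no)
open import Relation.Nullary.Decidable using (⌊_⌋; ⌊⌋-map′; map′; _×-dec_; T?)

open +-*-Solver using (solve; _:+_; _:*_; _:=_; con)
open import Algebra.Properties.CommutativeMonoid.Sum ℤ.*-1-commutativeMonoid
  using () renaming (sum to ∏; sum-cong-≗ to ∏-cong; ∑-distrib-+ to ∏-distrib-*)

-- For a prescribed map φ : V(H) → V(G) (that is, c ∘ φ = id) let B(φ) ⊆ E(H) be the set of
-- edges that φ maps onto edges of G.  For T ⊆ E(H), φ is a homomorphism from H[T] iff
-- T ⊆ B(φ), so the right-hand side equals Σ_φ Σ_{T ⊆ B(φ)} a_T, and Möbius inversion on the
-- Boolean lattice of edge sets turns the inner sum into Ψ(H[B(φ)]).  On the left, a vertex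
-- set S with c(S) = V(H) contains a section ψ of c, and |S| = |V(H)| forces S = ψ(V(H));
-- so the sets counted on the left are exactly the images of prescribed maps, each the image
-- of a unique one, and c restricts to a consistent isomorphism G[S] ≅ H[B(ψ)].  Counting
-- the pairs (S, φ) with S = φ(V(H)) in both orders gives the identity.

𝟙 : Bool → ℤ
𝟙 b = if b then + 1 else + 0

𝟙-∧ : ∀ a b → 𝟙 (a ∧ b) ≡ 𝟙 a * 𝟙 b
𝟙-∧ true  b = sym (ℤ.*-identityˡ (𝟙 b))
𝟙-∧ false b = refl

∧-true : ∀ a {b} → a ∧ b ≡ true → a ≡ true × b ≡ true
∧-true true b≡true = refl , b≡true

𝟙-nonzero : ∀ {b} → 𝟙 b ≢ + 0 → b ≡ true
𝟙-nonzero {true}  _   = refl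
𝟙-nonzero {false} b≢0 = ⊥-elim (b≢0 refl)

*-nonzeroˡ : ∀ a b → a * b ≢ + 0 → a ≢ + 0
*-nonzeroˡ a b ab≢0 refl = ab≢0 refl

*-nonzeroʳ : ∀ a b → a * b ≢ + 0 → b ≢ + 0
*-nonzeroʳ a b ab≢0 refl = ab≢0 (ℤ.*-zeroʳ a)

⇒ᵇ-sound : ∀ {a b} → (a ⇒ᵇ b) ≡ true → a ≡ true → b ≡ true
⇒ᵇ-sound {true} a⇒b refl = a⇒b

⇒ᵇ-complete : ∀ {a b} → (a ≡ true → b ≡ true) → (a ⇒ᵇ b) ≡ true
⇒ᵇ-complete {true}  a⇒b = a⇒b refl
⇒ᵇ-complete {false} a⇒b = refl

⌊⌋-sound : {P : Set} (d : Dec P) → ⌊ d ⌋ ≡ true → P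
⌊⌋-sound (yes p) _ = p

⌊⌋-complete : {P : Set} (d : Dec P) → P → ⌊ d ⌋ ≡ true
⌊⌋-complete (yes _) _ = refl
⌊⌋-complete (no ¬p) p = ⊥-elim (¬p p)

𝟙⌊⌋-yes : {P : Set} (d : Dec P) → P → 𝟙 ⌊ d ⌋ ≡ + 1
𝟙⌊⌋-yes d p = cong 𝟙 (⌊⌋-complete d p)

true-equivalent : ∀ {a b} → (a ≡ true → b ≡ true) → (b ≡ true → a ≡ true) → a ≡ b
true-equivalent to from = Bool.⇔→≡ (mk⇔ to from)

⌊⌋-cong : {P Q : Set} (d : Dec P) (e : Dec Q) → (P → Q) → (Q → P) → ⌊ d ⌋ ≡ ⌊ e ⌋
⌊⌋-cong d e P⇒Q Q⇒P = true-equivalent (⌊⌋-complete e ∘ P⇒Q ∘ ⌊⌋-sound d) (⌊⌋-complete d ∘ Q⇒P ∘ ⌊⌋-sound e)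

𝟙⌊⌋-nonzero : {P : Set} (d : Dec P) → 𝟙 ⌊ d ⌋ ≢ + 0 → P
𝟙⌊⌋-nonzero d = ⌊⌋-sound d ∘ 𝟙-nonzero

module _ {A : Set} where

  sumℤ-cong-∈ : ∀ xs {F G : A → ℤ} → (∀ {x} → x ∈ xs → F x ≡ G x) → sumℤ F xs ≡ sumℤ G xs
  sumℤ-cong-∈ []       e = refl
  sumℤ-cong-∈ (x ∷ xs) e = cong₂ _+ℤ_ (e (here refl)) (sumℤ-cong-∈ xs (e ∘ there))

  sumℤ-cong : ∀ xs {F G : A → ℤ} → (∀ x → F x ≡ G x) → sumℤ F xs ≡ sumℤ G xs
  sumℤ-cong xs e = sumℤ-cong-∈ xs (λ {x} _ → e x)

  sumℤ-zero : ∀ {xs} {F : A → ℤ} → All (λ x → F x ≡ + 0) xs → sumℤ F xs ≡ + 0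
  sumℤ-zero []         = refl
  sumℤ-zero (Fx≡0 ∷ z) rewrite Fx≡0 | sumℤ-zero z = refl

  sumℤ-nonzero : ∀ xs {F : A → ℤ} → sumℤ F xs ≢ + 0 → ∃[ x ] F x ≢ + 0
  sumℤ-nonzero []       s≢0 = ⊥-elim (s≢0 refl)
  sumℤ-nonzero (x ∷ xs) {F} s≢0 with F x ℤ.≟ + 0
  ... | no Fx≢0  = x , Fx≢0
  ... | yes Fx≡0 = sumℤ-nonzero xs λ s≡0 → s≢0 (cong₂ _+ℤ_ Fx≡0 s≡0)

  sumℤ-++ : ∀ xs ys (F : A → ℤ) → sumℤ F (xs ++ ys) ≡ sumℤ F xs +ℤ sumℤ F ys
  sumℤ-++ []       ys F = sym (ℤ.+-identityˡ _)
  sumℤ-++ (x ∷ xs) ys F rewrite sumℤ-++ xs ys F = sym (ℤ.+-assoc (F x) _ _)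

  sumℤ-distrib-+ : ∀ xs (F G : A → ℤ) → sumℤ (λ x → F x +ℤ G x) xs ≡ sumℤ F xs +ℤ sumℤ G xs
  sumℤ-distrib-+ []       F G = refl
  sumℤ-distrib-+ (x ∷ xs) F G rewrite sumℤ-distrib-+ xs F G =
    solve 4 (λ a b c d → (a :+ b) :+ (c :+ d) := (a :+ c) :+ (b :+ d)) refl
      (F x) (G x) (sumℤ F xs) (sumℤ G xs)

  *-distribˡ-sumℤ : ∀ xs k (F : A → ℤ) → k * sumℤ F xs ≡ sumℤ (λ x → k * F x) xs
  *-distribˡ-sumℤ []       k F = ℤ.*-zeroʳ k
  *-distribˡ-sumℤ (x ∷ xs) k F rewrite sym (*-distribˡ-sumℤ xs k F) = ℤ.*-distribˡ-+ k (F x) _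

  *-distribʳ-sumℤ : ∀ xs k (F : A → ℤ) → sumℤ F xs * k ≡ sumℤ (λ x → F x * k) xs
  *-distribʳ-sumℤ []       k F = ℤ.*-zeroˡ k
  *-distribʳ-sumℤ (x ∷ xs) k F rewrite sym (*-distribʳ-sumℤ xs k F) = ℤ.*-distribʳ-+ k (F x) _

  sumℤ-filterᵇ : ∀ xs (p : A → Bool) (F : A → ℤ) →
                 sumℤ F (filterᵇ p xs) ≡ sumℤ (λ x → 𝟙 (p x) * F x) xs
  sumℤ-filterᵇ []       p F = refl
  sumℤ-filterᵇ (x ∷ xs) p F with p x
  ... | true  = cong₂ _+ℤ_ (sym (ℤ.*-identityˡ (F x))) (sumℤ-filterᵇ xs p F)
  ... | false = trans (sumℤ-filterᵇ xs p F) (sym (ℤ.+-identityˡ _))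

  count≡sumℤ : ∀ (p : A → Bool) xs → + count p xs ≡ sumℤ (𝟙 ∘ p) xs
  count≡sumℤ p []       = refl
  count≡sumℤ p (x ∷ xs) with p x
  ... | true  = trans (ℤ.pos-+ 1 _) (cong (+ 1 +ℤ_) (count≡sumℤ p xs))
  ... | false = trans (count≡sumℤ p xs) (sym (ℤ.+-identityˡ _))

  sumℤ-one : ∀ xs → sumℤ {A} (λ _ → + 1) xs ≡ + length xs
  sumℤ-one []       = refl
  sumℤ-one (x ∷ xs) = trans (cong (+ 1 +ℤ_) (sumℤ-one xs)) (sym (ℤ.pos-+ 1 _))

  allᵇ-sound : ∀ {xs} {p : A → Bool} {x} → allᵇ xs p ≡ true → x ∈ xs → p x ≡ true
  allᵇ-sound {y ∷ _} {p} all-p (here refl)  = proj₁ (∧-true (p y) all-p)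
  allᵇ-sound {y ∷ _} {p} all-p (there x∈xs) = allᵇ-sound (proj₂ (∧-true (p y) all-p)) x∈xs

  allᵇ-complete : ∀ {xs} {p : A → Bool} → (∀ {x} → x ∈ xs → p x ≡ true) → allᵇ xs p ≡ true
  allᵇ-complete {[]}     all-p = refl
  allᵇ-complete {y ∷ xs} all-p = cong₂ _∧_ (all-p (here refl)) (allᵇ-complete (all-p ∘ there))

  anyᵇ-sound : ∀ xs {p : A → Bool} → anyᵇ xs p ≡ true → ∃[ x ] p x ≡ true
  anyᵇ-sound (y ∷ xs) {p} any-p with p y in py
  ... | true  = y , py
  ... | false = anyᵇ-sound xs any-p

  anyᵇ-complete : ∀ {xs} {p : A → Bool} {x} → x ∈ xs → p x ≡ true → anyᵇ xs p ≡ true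
  anyᵇ-complete (here refl) px rewrite px = refl
  anyᵇ-complete {y ∷ _} {p} (there x∈xs) px =
    trans (cong (p y ∨_) (anyᵇ-complete x∈xs px)) (Bool.∨-zeroʳ (p y))

  count-mono : ∀ xs {p q : A → Bool} → (∀ x → p x ≡ true → q x ≡ true) → count p xs ≤ count q xs
  count-mono []       p⊆q = z≤n
  count-mono (x ∷ xs) {p} {q} p⊆q with p x in px | q x in qx
  ... | true  | true  = s≤s (count-mono xs p⊆q)
  ... | false | true  = ℕ.m≤n⇒m≤1+n (count-mono xs p⊆q)
  ... | false | false = count-mono xs p⊆q
  ... | true  | false with () ← trans (sym (p⊆q x px)) qx

  count-mono-≡ : ∀ xs {p q : A → Bool} → (∀ x → p x ≡ true → q x ≡ true) → count p xs ≡ count q xs →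
                 ∀ {x} → x ∈ xs → q x ≡ true → p x ≡ true
  count-mono-≡ (y ∷ xs) {p} {q} p⊆q eq x∈ qx with p y in py | q y in qy
  ... | true  | true  = case x∈ of λ where
                          (here refl) → py
                          (there x∈xs) → count-mono-≡ xs p⊆q (ℕ.suc-injective eq) x∈xs qx
  ... | false | true  = ⊥-elim (ℕ.<-irrefl eq (s≤s (count-mono xs p⊆q)))
  ... | false | false = case x∈ of λ where
                          (here refl) → case trans (sym qx) qy of λ ()
                          (there x∈xs) → count-mono-≡ xs p⊆q eq x∈xs qx
  ... | true  | false with () ← trans (sym (p⊆q y py)) qy

sum-map-mono : {A : Set} (xs : List A) {f g : A → ℕ} → (∀ x → f x ≤ g x) →
               sum (map f xs) ≤ sum (map g xs)
sum-map-mono []       f≤g = z≤n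
sum-map-mono (x ∷ xs) f≤g = ℕ.+-mono-≤ (f≤g x) (sum-map-mono xs f≤g)

module _ {A B : Set} where

  sumℤ-map : ∀ xs (g : A → B) (F : B → ℤ) → sumℤ F (map g xs) ≡ sumℤ (F ∘ g) xs
  sumℤ-map []       g F = refl
  sumℤ-map (x ∷ xs) g F = cong (F (g x) +ℤ_) (sumℤ-map xs g F)

  sumℤ-concatMap : ∀ xs (f : A → List B) (F : B → ℤ) →
                   sumℤ F (concatMap f xs) ≡ sumℤ (λ x → sumℤ F (f x)) xs
  sumℤ-concatMap []       f F = refl
  sumℤ-concatMap (x ∷ xs) f F =
    trans (sumℤ-++ (f x) _ F) (cong (sumℤ F (f x) +ℤ_) (sumℤ-concatMap xs f F))

  sumℤ-comm : ∀ xs ys (F : A → B → ℤ) →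
              sumℤ (λ x → sumℤ (F x) ys) xs ≡ sumℤ (λ y → sumℤ (λ x → F x y) xs) ys
  sumℤ-comm []       ys F = sym (sumℤ-zero (All.universal (λ _ → refl) ys))
  sumℤ-comm (x ∷ xs) ys F rewrite sumℤ-comm xs ys F = sym (sumℤ-distrib-+ ys (F x) _)

count-cong : {A : Set} (xs : List A) {p q : A → Bool} → (∀ x → p x ≡ q x) → count p xs ≡ count q xs
count-cong xs {p} {q} p≡q = ℤ.+-injective (begin
  + count p xs        ≡⟨ count≡sumℤ p xs ⟩
  sumℤ (𝟙 ∘ p) xs     ≡⟨ sumℤ-cong xs (cong 𝟙 ∘ p≡q) ⟩
  sumℤ (𝟙 ∘ q) xs     ≡⟨ count≡sumℤ q xs ⟨
  + count q xs        ∎)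
  where open ≡-Reasoning

vanishes-off-support : {X : Set} {F : X → ℤ} {P : X → Set} →
                       (∀ x → F x ≢ + 0 → P x) → ∀ {x} → ¬ P x → F x ≡ + 0
vanishes-off-support {F = F} supp {x} ¬Px with F x ℤ.≟ + 0
... | yes Fx≡0 = Fx≡0
... | no  Fx≢0 = ⊥-elim (¬Px (supp x Fx≢0))

-- xs lists the ≈-class of y exactly once.  This is phrased through the sums it
-- controls because the lists enumerated below consist of functions, which can
-- only be compared pointwise.
OccursOnce : {X : Set} → (X → X → Set) → List X → X → Set
OccursOnce {X} _≈_ xs y =
  (F : X → ℤ) → (∀ x → F x ≢ + 0 → x ≈ y) → (∀ x → x ≈ y → F x ≡ F y) → sumℤ F xs ≡ F y

IsEnumeration : {X : Set} → List X → Set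
IsEnumeration {X} xs = Unique xs × (∀ (x : X) → x ∈ xs)

unique⇒occursOnce : {X : Set} {xs : List X} → Unique xs → ∀ {y} → y ∈ xs → OccursOnce _≡_ xs y
unique⇒occursOnce (x∉xs ∷ _) (here refl) F supp _ =
  trans (cong (F _ +ℤ_) (sumℤ-zero (All.map (λ x≢z → vanishes-off-support supp (x≢z ∘ sym)) x∉xs)))
        (ℤ.+-identityʳ _)
unique⇒occursOnce {xs = x ∷ xs} (x∉xs ∷ xs-unique) (there y∈xs) F supp const =
  trans (cong (_+ℤ sumℤ F xs) (vanishes-off-support supp (All.lookup x∉xs y∈xs)))
        (trans (ℤ.+-identityˡ _) (unique⇒occursOnce xs-unique y∈xs F supp const))

enumeration⇒occursOnce : {X : Set} {xs : List X} → IsEnumeration xs → ∀ y → OccursOnce _≡_ xs y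
enumeration⇒occursOnce (xs-unique , xs-complete) y = unique⇒occursOnce xs-unique (xs-complete y)

occursOnce-concatMap :
  {X Y Z : Set} {_≈₁_ : X → X → Set} {_≈₂_ : Y → Y → Set} {_≈_ : Z → Z → Set}
  (xs : List X) (ys : List Y) (build : X → Y → Z) {x* : X} {y* : Y} {z : Z} →
  x* ≈₁ x* → y* ≈₂ y* →
  (∀ {x y} → build x y ≈ z → x ≈₁ x* × y ≈₂ y*) →
  (∀ {x y} → x ≈₁ x* → y ≈₂ y* → build x y ≈ z) →
  OccursOnce _≈₁_ xs x* → OccursOnce _≈₂_ ys y* →
  OccursOnce _≈_ (concatMap (λ x → map (build x) ys) xs) z
occursOnce-concatMap {X} {_≈₁_ = _≈₁_} {_≈₂_ = _≈₂_} xs ys build {x*} {y*} {z}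
  x*≈x* y*≈y* split join once₁ once₂ F supp const = begin
    sumℤ F (concatMap (λ x → map (build x) ys) xs)  ≡⟨ sumℤ-concatMap xs _ F ⟩
    sumℤ (λ x → sumℤ F (map (build x) ys)) xs      ≡⟨ sumℤ-cong xs (λ x → sumℤ-map ys (build x) F) ⟩
    sumℤ row xs                                     ≡⟨ once₁ row row-supp row-const ⟩
    row x*                                          ≡⟨ row≡ x* x*≈x* ⟩
    F z                                             ∎
  where
  open ≡-Reasoning
  row : X → ℤ
  row x = sumℤ (F ∘ build x) ys
  row≡ : ∀ x → x ≈₁ x* → row x ≡ F z
  row≡ x x≈x* = trans (once₂ (F ∘ build x) (λ y Fxy≢0 → proj₂ (split (supp _ Fxy≢0))) row-entry-const)
                      (const _ (join x≈x* y*≈y*))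
    where
    row-entry-const : ∀ y → y ≈₂ y* → F (build x y) ≡ F (build x y*)
    row-entry-const y y≈y* = trans (const _ (join x≈x* y≈y*)) (sym (const _ (join x≈x* y*≈y*)))
  row-supp : ∀ x → row x ≢ + 0 → x ≈₁ x*
  row-supp x row≢0 with sumℤ-nonzero ys row≢0
  ... | _ , Fxy≢0 = proj₁ (split (supp _ Fxy≢0))
  row-const : ∀ x → x ≈₁ x* → row x ≡ row x*
  row-const x x≈x* = trans (row≡ x x≈x*) (sym (row≡ x* x*≈x*))

occursOnce-allFuns : {X : Set} {_≈_ : X → X → Set} (xs : List X) → (∀ x → x ≈ x) →
                     (∀ y → OccursOnce _≈_ xs y) →
                     ∀ n (f : Fin n → X) → OccursOnce (Pointwise _≈_) (allFuns n xs) f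
occursOnce-allFuns xs ≈-refl once zero    f F supp const = trans (ℤ.+-identityʳ _) (const _ λ ())
occursOnce-allFuns {_≈_ = _≈_} xs ≈-refl once (suc n) f =
  occursOnce-concatMap {_≈₁_ = _≈_} {_≈₂_ = Pointwise _≈_} {_≈_ = Pointwise _≈_}
    xs (allFuns n xs) finCases (≈-refl _) (λ _ → ≈-refl _)
    (λ eq → eq zero , eq ∘ suc) (λ { a≈ g≈ zero → a≈ ; a≈ g≈ (suc i) → g≈ i })
    (once (f zero)) (occursOnce-allFuns xs ≈-refl once n (f ∘ suc))

bools-enumeration : IsEnumeration bools
bools-enumeration = ((λ ()) ∷ []) ∷ [] ∷ [] , λ { true → here refl ; false → there (here refl) }

∈-allV : ∀ G v → v ∈ allV G
∈-allV G (inj₁ i) = ∈-++⁺ˡ (∈-map⁺ inj₁ (∈-allFin i))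
∈-allV G (inj₂ j) = ∈-++⁺ʳ _ (∈-map⁺ inj₂ (∈-allFin j))

allV-enumeration : ∀ G → IsEnumeration (allV G)
allV-enumeration G =
  Unique.++⁺ (Unique.map⁺ inj₁-injective (Unique.allFin⁺ (n₁ G)))
             (Unique.map⁺ inj₂-injective (Unique.allFin⁺ (n₂ G))) disjoint ,
  ∈-allV G
  where
  disjoint : ∀ {v} → ¬ (v ∈ map inj₁ (allFin (n₁ G)) × v ∈ map inj₂ (allFin (n₂ G)))
  disjoint (v∈₁ , v∈₂) with ∈-map⁻ inj₁ v∈₁ | ∈-map⁻ inj₂ v∈₂
  ... | _ , _ , refl | _ , _ , ()

occursOnce-allSubsets : ∀ n (S : Fin n → Bool) → OccursOnce _≗_ (allSubsets n) S
occursOnce-allSubsets = occursOnce-allFuns bools (λ _ → refl) (enumeration⇒occursOnce bools-enumeration)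

occursOnce-allEdgeSets : ∀ H (B : EdgeSet H) → OccursOnce (Pointwise _≗_) (allEdgeSets H) B
occursOnce-allEdgeSets H =
  occursOnce-allFuns (allSubsets (n₂ H)) (λ _ _ → refl) (occursOnce-allSubsets (n₂ H)) (n₁ H)

occursOnce-allMaps : ∀ H G (φ : V H → V G) → OccursOnce _≗_ (allMaps H G) φ
occursOnce-allMaps H G φ =
  occursOnce-concatMap {_≈₁_ = Pointwise _≡_} {_≈₂_ = Pointwise _≡_} {_≈_ = _≗_}
    (allFuns (n₁ H) (allV G)) (allFuns (n₂ H) (allV G)) [_,_] (λ _ → refl) (λ _ → refl)
    (λ eq → eq ∘ inj₁ , eq ∘ inj₂) (λ { eq₁ eq₂ (inj₁ i) → eq₁ i ; eq₁ eq₂ (inj₂ j) → eq₂ j })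
    (allFuns-once (n₁ H) (φ ∘ inj₁)) (allFuns-once (n₂ H) (φ ∘ inj₂))
  where
  allFuns-once : ∀ n (f : Fin n → V G) → OccursOnce (Pointwise _≡_) (allFuns n (allV G)) f
  allFuns-once = occursOnce-allFuns (allV G) (λ _ → refl) (enumeration⇒occursOnce (allV-enumeration G))

_≐_ : {G : BipGraph} → VSub G → VSub G → Set
_≐_ {G} S S′ = ∀ v → inVSub G S v ≡ inVSub G S′ v

occursOnce-allVSub : ∀ G (S : VSub G) → OccursOnce (_≐_ {G}) (allVSub G) S
occursOnce-allVSub G S =
  occursOnce-concatMap {_≈₁_ = _≗_} {_≈₂_ = _≗_} {_≈_ = _≐_ {G}}
    (allSubsets (n₁ G)) (allSubsets (n₂ G)) _,_ (λ _ → refl) (λ _ → refl)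
    (λ eq → eq ∘ inj₁ , eq ∘ inj₂) (λ { eq₁ eq₂ (inj₁ i) → eq₁ i ; eq₁ eq₂ (inj₂ j) → eq₂ j })
    (occursOnce-allSubsets (n₁ G) (proj₁ S)) (occursOnce-allSubsets (n₂ G) (proj₂ S))

∏-zero : ∀ {n} (h : Fin n → ℤ) i → h i ≡ + 0 → ∏ h ≡ + 0
∏-zero h zero    hi≡0 = trans (cong (_* ∏ (h ∘ suc)) hi≡0) (ℤ.*-zeroˡ (∏ (h ∘ suc)))
∏-zero h (suc i) hi≡0 = trans (cong (h zero *_) (∏-zero (h ∘ suc) i hi≡0)) (ℤ.*-zeroʳ (h zero))

∏-nonzero : ∀ {n} (h : Fin n → ℤ) → ∏ h ≢ + 0 → ∀ i → h i ≢ + 0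
∏-nonzero h ∏≢0 i hi≡0 = ∏≢0 (∏-zero h i hi≡0)

sumℤ-allFuns-∏ : {X : Set} (xs : List X) → ∀ n (h : Fin n → X → ℤ) →
                 sumℤ (λ f → ∏ (λ i → h i (f i))) (allFuns n xs) ≡ ∏ (λ i → sumℤ (h i) xs)
sumℤ-allFuns-∏ xs zero    h = refl
sumℤ-allFuns-∏ {X} xs (suc n) h = begin
  sumℤ F (allFuns (suc n) xs)
    ≡⟨ sumℤ-concatMap xs _ F ⟩
  sumℤ (λ a → sumℤ F (map (finCases a) (allFuns n xs))) xs
    ≡⟨ sumℤ-cong xs (λ a → sumℤ-map (allFuns n xs) (finCases a) F) ⟩
  sumℤ (λ a → sumℤ (λ f → h zero a * F′ f) (allFuns n xs)) xs
    ≡⟨ sumℤ-cong xs (λ a → sym (*-distribˡ-sumℤ (allFuns n xs) (h zero a) F′)) ⟩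
  sumℤ (λ a → h zero a * sumℤ F′ (allFuns n xs)) xs
    ≡⟨ sumℤ-cong xs (λ a → cong (h zero a *_) (sumℤ-allFuns-∏ xs n (h ∘ suc))) ⟩
  sumℤ (λ a → h zero a * ∏ (λ i → sumℤ (h (suc i)) xs)) xs
    ≡⟨ sym (*-distribʳ-sumℤ xs _ (h zero)) ⟩
  sumℤ (h zero) xs * ∏ (λ i → sumℤ (h (suc i)) xs) ∎
  where
  open ≡-Reasoning
  F : (Fin (suc n) → X) → ℤ
  F f = ∏ (λ i → h i (f i))
  F′ : (Fin n → X) → ℤ
  F′ f = ∏ (λ i → h (suc i) (f i))

𝟙-allᵇ-tabulate : {A : Set} → ∀ n (g : Fin n → A) (p : A → Bool) →
                  𝟙 (allᵇ (tabulate g) p) ≡ ∏ (λ i → 𝟙 (p (g i)))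
𝟙-allᵇ-tabulate zero    g p = refl
𝟙-allᵇ-tabulate (suc n) g p =
  trans (𝟙-∧ (p (g zero)) _) (cong (𝟙 (p (g zero)) *_) (𝟙-allᵇ-tabulate n (g ∘ suc) p))

sign : ℕ → ℤ
sign k = (- + 1) ^ k

signᵇ : Bool → ℤ
signᵇ b = if b then - + 1 else + 1

sign-+ : ∀ m n → sign (m ℕ.+ n) ≡ sign m * sign n
sign-+ = ℤ.^-distribˡ-+-* (- + 1)

sign-sq : ∀ k → sign k * sign k ≡ + 1
sign-sq zero    = refl
sign-sq (suc k) = trans (solve 1 (λ a → (con (- + 1) :* a) :* (con (- + 1) :* a) := a :* a) refl (sign k))
                        (sign-sq k)

sign-∸ : ∀ {m n} → n ≤ m → sign (m ∸ n) ≡ sign m * sign n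
sign-∸ {m} {n} n≤m = begin
  sign (m ∸ n)                     ≡⟨ ℤ.*-identityʳ _ ⟨
  sign (m ∸ n) * + 1               ≡⟨ cong (sign (m ∸ n) *_) (sign-sq n) ⟨
  sign (m ∸ n) * (sign n * sign n) ≡⟨ ℤ.*-assoc (sign (m ∸ n)) _ _ ⟨
  sign (m ∸ n) * sign n * sign n   ≡⟨ cong (_* sign n) (sign-+ (m ∸ n) n) ⟨
  sign (m ∸ n ℕ.+ n) * sign n      ≡⟨ cong (λ k → sign k * sign n) (ℕ.m∸n+n≡m n≤m) ⟩
  sign m * sign n                  ∎
  where open ≡-Reasoning

sign-count-tabulate : {A : Set} → ∀ n (g : Fin n → A) (p : A → Bool) →
                      sign (count p (tabulate g)) ≡ ∏ (λ i → signᵇ (p (g i)))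
sign-count-tabulate zero    g p = refl
sign-count-tabulate (suc n) g p with p (g zero)
... | true  = cong (- + 1 *_) (sign-count-tabulate n (g ∘ suc) p)
... | false = trans (sign-count-tabulate n (g ∘ suc) p) (sym (ℤ.*-identityˡ _))

sign-sum-tabulate : {A : Set} → ∀ n (g : Fin n → A) (h : A → ℕ) →
                    sign (sum (map h (tabulate g))) ≡ ∏ (λ i → sign (h (g i)))
sign-sum-tabulate zero    g h = refl
sign-sum-tabulate (suc n) g h =
  trans (sign-+ (h (g zero)) _) (cong (sign (h (g zero)) *_) (sign-sum-tabulate n (g ∘ suc) h))

-- Möbius inversion on the edge sets of H

module EdgeSubsets (H : BipGraph) where

  infix 5 _⊑_
  _⊑_ : EdgeSet H → EdgeSet H → Bool
  A ⊑ T = _⊆ᵇ_ {H} A T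

  edgeSets : List (EdgeSet H)
  edgeSets = allEdgeSets H

  ⊑-sound : ∀ {A T} → A ⊑ T ≡ true → ∀ i j → A i j ≡ true → T i j ≡ true
  ⊑-sound {A} {T} A⊑T i j = ⇒ᵇ-sound (allᵇ-sound (allᵇ-sound A⊑T (∈-allFin i)) (∈-allFin j))

  ⊑-complete : ∀ {A T} → (∀ i j → A i j ≡ true → T i j ≡ true) → A ⊑ T ≡ true
  ⊑-complete {A} {T} A⊆T =
    allᵇ-complete {xs = allFin (n₁ H)} {p = λ i → allᵇ (allFin (n₂ H)) (λ j → A i j ⇒ᵇ T i j)}
      (λ {i} _ → allᵇ-complete {xs = allFin (n₂ H)} {p = λ j → A i j ⇒ᵇ T i j}
                   (λ {j} _ → ⇒ᵇ-complete (A⊆T i j)))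

  ⊑-trans : ∀ {A B C} → A ⊑ B ≡ true → B ⊑ C ≡ true → A ⊑ C ≡ true
  ⊑-trans {A} {B} {C} A⊑B B⊑C =
    ⊑-complete {A} {C} (λ i j → ⊑-sound {B} {C} B⊑C i j ∘ ⊑-sound {A} {B} A⊑B i j)

  #edges-mono : ∀ {A T} → A ⊑ T ≡ true → #edges H A ≤ #edges H T
  #edges-mono {A} {T} A⊑T =
    sum-map-mono (allFin (n₁ H)) (λ i → count-mono (allFin (n₂ H)) (⊑-sound {A} {T} A⊑T i))

  ∏∏ : (Fin (n₁ H) → Fin (n₂ H) → ℤ) → ℤ
  ∏∏ k = ∏ (λ i → ∏ (k i))

  ∏∏-cong : ∀ {h k} → (∀ i j → h i j ≡ k i j) → ∏∏ h ≡ ∏∏ k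
  ∏∏-cong h≡k = ∏-cong (λ i → ∏-cong (h≡k i))

  ∏∏-distrib-* : ∀ h k → ∏∏ h * ∏∏ k ≡ ∏∏ (λ i j → h i j * k i j)
  ∏∏-distrib-* h k = sym (trans (∏-cong (λ i → ∏-distrib-* (h i) (k i))) (∏-distrib-* (∏ ∘ h) (∏ ∘ k)))

  ∏∏-nonzero : ∀ k → ∏∏ k ≢ + 0 → ∀ i j → k i j ≢ + 0
  ∏∏-nonzero k ∏∏≢0 i = ∏-nonzero (k i) (∏-nonzero _ ∏∏≢0 i)

  sumℤ-edgeSets-∏∏ : (k : Fin (n₁ H) → Fin (n₂ H) → Bool → ℤ) →
    sumℤ (λ T → ∏∏ (λ i j → k i j (T i j))) edgeSets ≡ ∏∏ (λ i j → sumℤ (k i j) bools)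
  sumℤ-edgeSets-∏∏ k =
    trans (sumℤ-allFuns-∏ (allSubsets (n₂ H)) (n₁ H) (λ i row → ∏ (λ j → k i j (row j))))
          (∏-cong (λ i → sumℤ-allFuns-∏ bools (n₂ H) (k i)))

  𝟙-⊑ : ∀ A T → 𝟙 (A ⊑ T) ≡ ∏∏ (λ i j → 𝟙 (A i j ⇒ᵇ T i j))
  𝟙-⊑ A T = trans (𝟙-allᵇ-tabulate (n₁ H) (λ i → i) (λ i → allᵇ (allFin (n₂ H)) (λ j → A i j ⇒ᵇ T i j)))
                  (∏-cong (λ i → 𝟙-allᵇ-tabulate (n₂ H) (λ j → j) (λ j → A i j ⇒ᵇ T i j)))

  sign-#edges : ∀ T → sign (#edges H T) ≡ ∏∏ (λ i j → signᵇ (T i j))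
  sign-#edges T = trans (sign-sum-tabulate (n₁ H) (λ i → i) (λ i → card (T i)))
                        (∏-cong (λ i → sign-count-tabulate (n₂ H) (λ j → j) (T i)))

  signedInterval : EdgeSet H → EdgeSet H → EdgeSet H → ℤ
  signedInterval A B T = 𝟙 (A ⊑ T) * 𝟙 (T ⊑ B) * sign (#edges H T)

  -- Σ_{A ⊆ T ⊆ B} (-1)^|T| factorises over the coordinates of the edge sets
  interval-sum : ∀ A B → sumℤ (signedInterval A B) edgeSets
                         ≡ ∏∏ (λ i j → 𝟙 ⌊ A i j Bool.≟ B i j ⌋ * signᵇ (B i j))
  interval-sum A B = begin
    sumℤ (signedInterval A B) edgeSets
      ≡⟨ sumℤ-cong edgeSets factorise ⟩
    sumℤ (λ T → ∏∏ (λ i j → k i j (T i j))) edgeSets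
      ≡⟨ sumℤ-edgeSets-∏∏ k ⟩
    ∏∏ (λ i j → sumℤ (k i j) bools)
      ≡⟨ ∏∏-cong (λ i j → coordinate (A i j) (B i j)) ⟩
    ∏∏ (λ i j → 𝟙 ⌊ A i j Bool.≟ B i j ⌋ * signᵇ (B i j)) ∎
    where
    open ≡-Reasoning
    k : Fin (n₁ H) → Fin (n₂ H) → Bool → ℤ
    k i j t = 𝟙 (A i j ⇒ᵇ t) * 𝟙 (t ⇒ᵇ B i j) * signᵇ t
    factorise : ∀ T → signedInterval A B T ≡ ∏∏ (λ i j → k i j (T i j))
    factorise T = begin
      𝟙 (A ⊑ T) * 𝟙 (T ⊑ B) * sign (#edges H T)
        ≡⟨ cong₂ _*_ (cong₂ _*_ (𝟙-⊑ A T) (𝟙-⊑ T B)) (sign-#edges T) ⟩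
      ∏∏ (λ i j → 𝟙 (A i j ⇒ᵇ T i j)) * ∏∏ (λ i j → 𝟙 (T i j ⇒ᵇ B i j)) * ∏∏ (λ i j → signᵇ (T i j))
        ≡⟨ cong (_* ∏∏ (λ i j → signᵇ (T i j))) (∏∏-distrib-* _ _) ⟩
      ∏∏ (λ i j → 𝟙 (A i j ⇒ᵇ T i j) * 𝟙 (T i j ⇒ᵇ B i j)) * ∏∏ (λ i j → signᵇ (T i j))
        ≡⟨ ∏∏-distrib-* _ _ ⟩
      ∏∏ (λ i j → k i j (T i j)) ∎
    coordinate : ∀ a b → sumℤ (λ t → 𝟙 (a ⇒ᵇ t) * 𝟙 (t ⇒ᵇ b) * signᵇ t) bools ≡ 𝟙 ⌊ a Bool.≟ b ⌋ * signᵇ b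
    coordinate true  true  = refl
    coordinate true  false = refl
    coordinate false true  = refl
    coordinate false false = refl

  sign-#edges-cong : ∀ {A B} → Pointwise _≗_ A B → sign (#edges H A) ≡ sign (#edges H B)
  sign-#edges-cong {A} {B} A≐B =
    trans (sign-#edges A) (trans (∏∏-cong (λ i j → cong signᵇ (A≐B i j))) (sym (sign-#edges B)))

  interval-collapse : (w : EdgeSet H → ℤ) → (∀ {A B} → Pointwise _≗_ A B → w A ≡ w B) → ∀ B →
    sumℤ (λ A → w A * sumℤ (signedInterval A B) edgeSets) edgeSets
    ≡ w B * sign (#edges H B)
  interval-collapse w w-cong B = begin
    sumℤ (λ A → w A * sumℤ (signedInterval A B) edgeSets) edgeSets
      ≡⟨ sumℤ-cong edgeSets (λ A → cong (w A *_) (interval-sum A B)) ⟩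
    sumℤ (λ A → w A * δ A) edgeSets
      ≡⟨ occursOnce-allEdgeSets H B (λ A → w A * δ A) supp const ⟩
    w B * δ B
      ≡⟨ cong (w B *_) (trans (∏∏-cong (λ i j → δ-diag (B i j))) (sym (sign-#edges B))) ⟩
    w B * sign (#edges H B) ∎
    where
    open ≡-Reasoning
    δ : EdgeSet H → ℤ
    δ A = ∏∏ (λ i j → 𝟙 ⌊ A i j Bool.≟ B i j ⌋ * signᵇ (B i j))
    δ-diag : ∀ b → 𝟙 ⌊ b Bool.≟ b ⌋ * signᵇ b ≡ signᵇ b
    δ-diag true  = refl
    δ-diag false = refl
    supp : ∀ A → w A * δ A ≢ + 0 → Pointwise _≗_ A B
    supp A wδ≢0 i j = 𝟙⌊⌋-nonzero (A i j Bool.≟ B i j)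
      (*-nonzeroˡ _ _ (∏∏-nonzero _ (*-nonzeroʳ (w A) (δ A) wδ≢0) i j))
    const : ∀ A → Pointwise _≗_ A B → w A * δ A ≡ w B * δ B
    const A A≐B = cong₂ _*_ (w-cong A≐B)
      (∏∏-cong (λ i j → cong (λ a → 𝟙 ⌊ a Bool.≟ B i j ⌋ * signᵇ (B i j)) (A≐B i j)))

  möbiusCoeff : (EdgeSet H → ℤ) → EdgeSet H → ℤ
  möbiusCoeff g T = sumℤ (λ A → g A * sign (#edges H T ∸ #edges H A)) (subsetsOf H T)

  möbiusCoeff-expand : ∀ g T B → möbiusCoeff g T * 𝟙 (T ⊑ B) ≡
    sumℤ (λ A → g A * sign (#edges H A) * signedInterval A B T) edgeSets
  möbiusCoeff-expand g T B = begin
    möbiusCoeff g T * 𝟙 (T ⊑ B)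
      ≡⟨ cong (_* 𝟙 (T ⊑ B)) (sumℤ-filterᵇ edgeSets (_⊑ T) (λ A → g A * sign (#edges H T ∸ #edges H A))) ⟩
    sumℤ (λ A → 𝟙 (A ⊑ T) * (g A * sign (#edges H T ∸ #edges H A))) edgeSets * 𝟙 (T ⊑ B)
      ≡⟨ *-distribʳ-sumℤ edgeSets (𝟙 (T ⊑ B)) (λ A → 𝟙 (A ⊑ T) * (g A * sign (#edges H T ∸ #edges H A))) ⟩
    sumℤ (λ A → 𝟙 (A ⊑ T) * (g A * sign (#edges H T ∸ #edges H A)) * 𝟙 (T ⊑ B)) edgeSets
      ≡⟨ sumℤ-cong edgeSets term ⟩
    sumℤ (λ A → g A * sign (#edges H A) * signedInterval A B T) edgeSets ∎
    where
    open ≡-Reasoning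
    term : ∀ A → 𝟙 (A ⊑ T) * (g A * sign (#edges H T ∸ #edges H A)) * 𝟙 (T ⊑ B)
                 ≡ g A * sign (#edges H A) * signedInterval A B T
    term A with A ⊑ T in A⊑T
    ... | false = solve 5 (λ t a s r u → con (+ 0) :* (a :* s) :* t := a :* r :* (con (+ 0) :* t :* u)) refl
                    (𝟙 (T ⊑ B)) (g A) (sign (#edges H T ∸ #edges H A))
                    (sign (#edges H A)) (sign (#edges H T))
    ... | true rewrite sign-∸ (#edges-mono {A} {T} A⊑T) =
      solve 4 (λ t a u r → con (+ 1) :* (a :* (u :* r)) :* t := a :* r :* (con (+ 1) :* t :* u)) refl
        (𝟙 (T ⊑ B)) (g A) (sign (#edges H T)) (sign (#edges H A))

  möbius-inversion : (g : EdgeSet H → ℤ) → (∀ {A B} → Pointwise _≗_ A B → g A ≡ g B) →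
                     ∀ {U B} → B ⊑ U ≡ true →
                     sumℤ (λ T → möbiusCoeff g T * 𝟙 (T ⊑ B)) (subsetsOf H U) ≡ g B
  möbius-inversion g g-cong {U} {B} B⊑U = begin
    sumℤ (λ T → möbiusCoeff g T * 𝟙 (T ⊑ B)) (subsetsOf H U)
      ≡⟨ sumℤ-filterᵇ edgeSets (_⊑ U) (λ T → möbiusCoeff g T * 𝟙 (T ⊑ B)) ⟩
    sumℤ (λ T → 𝟙 (T ⊑ U) * (möbiusCoeff g T * 𝟙 (T ⊑ B))) edgeSets
      ≡⟨ sumℤ-cong edgeSets absorb ⟩
    sumℤ (λ T → möbiusCoeff g T * 𝟙 (T ⊑ B)) edgeSets
      ≡⟨ sumℤ-cong edgeSets (λ T → möbiusCoeff-expand g T B) ⟩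
    sumℤ (λ T → sumℤ (λ A → w A * signedInterval A B T) edgeSets) edgeSets
      ≡⟨ sumℤ-comm edgeSets edgeSets (λ T A → w A * signedInterval A B T) ⟩
    sumℤ (λ A → sumℤ (λ T → w A * signedInterval A B T) edgeSets) edgeSets
      ≡⟨ sumℤ-cong edgeSets (λ A → *-distribˡ-sumℤ edgeSets (w A) (signedInterval A B)) ⟨
    sumℤ (λ A → w A * sumℤ (signedInterval A B) edgeSets) edgeSets
      ≡⟨ interval-collapse w (λ A≐B → cong₂ _*_ (g-cong A≐B) (sign-#edges-cong A≐B)) B ⟩
    g B * sign (#edges H B) * sign (#edges H B)
      ≡⟨ trans (ℤ.*-assoc (g B) _ _) (cong (g B *_) (sign-sq (#edges H B))) ⟩
    g B * + 1
      ≡⟨ ℤ.*-identityʳ (g B) ⟩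
    g B ∎
    where
    open ≡-Reasoning
    w : EdgeSet H → ℤ
    w A = g A * sign (#edges H A)
    absorb : ∀ T → 𝟙 (T ⊑ U) * (möbiusCoeff g T * 𝟙 (T ⊑ B)) ≡ möbiusCoeff g T * 𝟙 (T ⊑ B)
    absorb T with T ⊑ B in T⊑B
    ... | true  rewrite ⊑-trans {T} {B} {U} T⊑B B⊑U = ℤ.*-identityˡ _
    ... | false = trans (cong (𝟙 (T ⊑ U) *_) (ℤ.*-zeroʳ (möbiusCoeff g T)))
                        (trans (ℤ.*-zeroʳ (𝟙 (T ⊑ U))) (sym (ℤ.*-zeroʳ (möbiusCoeff g T))))

-- double counting the pairs (x , y) with κ x ≡ y and ψ y ≡ x
count-fixedPoints-section :
  {X Y : Set} (_≟X_ : DecidableEquality X) (_≟Y_ : DecidableEquality Y)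
  {xs : List X} {ys : List Y} → IsEnumeration xs → IsEnumeration ys →
  (κ : X → Y) (ψ : Y → X) → (∀ y → κ (ψ y) ≡ y) →
  count (λ x → ⌊ ψ (κ x) ≟X x ⌋) xs ≡ length ys
count-fixedPoints-section {X} {Y} _≟X_ _≟Y_ {xs} {ys} xs-enum ys-enum κ ψ κψ≡id = ℤ.+-injective (begin
  + count (λ x → ⌊ ψ (κ x) ≟X x ⌋) xs  ≡⟨ count≡sumℤ _ xs ⟩
  sumℤ (λ x → δX (ψ (κ x)) x) xs       ≡⟨ sumℤ-cong xs (sym ∘ sum-over-ys) ⟩
  sumℤ (λ x → sumℤ (λ y → δY (κ x) y * δX (ψ y) x) ys) xs
                                         ≡⟨ sumℤ-comm xs ys (λ x y → δY (κ x) y * δX (ψ y) x) ⟩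
  sumℤ (λ y → sumℤ (λ x → δY (κ x) y * δX (ψ y) x) xs) ys
                                         ≡⟨ sumℤ-cong ys sum-over-xs ⟩
  sumℤ (λ _ → + 1) ys                   ≡⟨ sumℤ-one ys ⟩
  + length ys                            ∎)
  where
  open ≡-Reasoning
  δX : X → X → ℤ
  δX a b = 𝟙 ⌊ a ≟X b ⌋
  δY : Y → Y → ℤ
  δY a b = 𝟙 ⌊ a ≟Y b ⌋
  sum-over-ys : ∀ x → sumℤ (λ y → δY (κ x) y * δX (ψ y) x) ys ≡ δX (ψ (κ x)) x
  sum-over-ys x =
    trans (enumeration⇒occursOnce ys-enum (κ x) (λ y → δY (κ x) y * δX (ψ y) x)
            (λ y t≢0 → sym (𝟙⌊⌋-nonzero (κ x ≟Y y) (*-nonzeroˡ _ _ t≢0))) (λ { _ refl → refl }))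
          (trans (cong (_* δX (ψ (κ x)) x) (𝟙⌊⌋-yes (κ x ≟Y κ x) refl)) (ℤ.*-identityˡ _))
  sum-over-xs : ∀ y → sumℤ (λ x → δY (κ x) y * δX (ψ y) x) xs ≡ + 1
  sum-over-xs y =
    trans (enumeration⇒occursOnce xs-enum (ψ y) (λ x → δY (κ x) y * δX (ψ y) x)
            (λ x t≢0 → sym (𝟙⌊⌋-nonzero (ψ y ≟X x) (*-nonzeroʳ (δY (κ x) y) _ t≢0))) (λ { _ refl → refl }))
          (cong₂ _*_ (𝟙⌊⌋-yes (κ (ψ y) ≟Y y) (κψ≡id y)) (𝟙⌊⌋-yes (ψ y ≟X ψ y) refl))

lookup-injective : {A : Set} {xs : List A} → Unique xs → ∀ k l → lookup xs k ≡ lookup xs l → k ≡ l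
lookup-injective (_ ∷ _)       zero    zero    _  = refl
lookup-injective (x∉xs ∷ _)    zero    (suc l) eq = ⊥-elim (All.lookup x∉xs (∈-lookup l) eq)
lookup-injective (x∉xs ∷ _)    (suc k) zero    eq = ⊥-elim (All.lookup x∉xs (∈-lookup k) (sym eq))
lookup-injective (_ ∷ xs-uniq) (suc k) (suc l) eq = cong suc (lookup-injective xs-uniq k l eq)

lookup-⤖ : {A B : Set} {xs : List A} → Unique xs → (κ : A → B) →
           (∀ {x y} → x ∈ xs → y ∈ xs → κ x ≡ κ y → x ≡ y) →
           (∀ b → ∃[ x ] x ∈ xs × κ x ≡ b) →
           Fin (length xs) ⤖ B
lookup-⤖ {xs = xs} xs-unique κ κ-injective κ-surjective = mk⤖ {to = κ ∘ lookup xs} (injective , surjective)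
  where
  injective : ∀ {k l} → κ (lookup xs k) ≡ κ (lookup xs l) → k ≡ l
  injective {k} {l} eq = lookup-injective xs-unique k l (κ-injective (∈-lookup k) (∈-lookup l) eq)
  surjective : ∀ b → ∃[ k ] (∀ {l} → l ≡ k → κ (lookup xs l) ≡ b)
  surjective b with κ-surjective b
  ... | x , x∈xs , κx≡b = Any.index x∈xs , λ { refl → trans (cong κ (sym (lookup-index x∈xs))) κx≡b }

vertex-≟ : (G : BipGraph) → DecidableEquality (V G)
vertex-≟ G = ≡-dec Fin._≟_ Fin._≟_

eqVᵇ≡⌊≟⌋ : ∀ G (v w : V G) → eqVᵇ G v w ≡ ⌊ vertex-≟ G v w ⌋
eqVᵇ≡⌊≟⌋ G (inj₁ i) (inj₁ i′) = sym (⌊⌋-map′ (cong inj₁) inj₁-injective (i Fin.≟ i′))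
eqVᵇ≡⌊≟⌋ G (inj₁ i) (inj₂ j′) = refl
eqVᵇ≡⌊≟⌋ G (inj₂ j) (inj₁ i′) = refl
eqVᵇ≡⌊≟⌋ G (inj₂ j) (inj₂ j′) = sym (⌊⌋-map′ (cong inj₂) inj₂-injective (j Fin.≟ j′))

eqVᵇ-sound : ∀ G {v w} → eqVᵇ G v w ≡ true → v ≡ w
eqVᵇ-sound G {v} {w} v≡ᵇw = ⌊⌋-sound (vertex-≟ G v w) (trans (sym (eqVᵇ≡⌊≟⌋ G v w)) v≡ᵇw)

eqVᵇ-refl : ∀ G v → eqVᵇ G v v ≡ true
eqVᵇ-refl G v = trans (eqVᵇ≡⌊≟⌋ G v v) (⌊⌋-complete (vertex-≟ G v v) refl)

adj-sym : ∀ G u v → adj G u v ≡ adj G v u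
adj-sym G (inj₁ i) (inj₁ i′) = refl
adj-sym G (inj₁ i) (inj₂ j)  = refl
adj-sym G (inj₂ j) (inj₁ i)  = refl
adj-sym G (inj₂ j) (inj₂ j′) = refl

count-allV : ∀ G S → count (inVSub G S) (allV G) ≡ card (proj₁ S) ℕ.+ card (proj₂ S)
count-allV G S = ℤ.+-injective (begin
  + count (inVSub G S) (allV G)
    ≡⟨ count≡sumℤ (inVSub G S) (allV G) ⟩
  sumℤ (𝟙 ∘ inVSub G S) (allV G)
    ≡⟨ sumℤ-++ (map inj₁ (allFin (n₁ G))) _ (𝟙 ∘ inVSub G S) ⟩
  sumℤ (𝟙 ∘ inVSub G S) (map inj₁ (allFin (n₁ G))) +ℤ sumℤ (𝟙 ∘ inVSub G S) (map inj₂ (allFin (n₂ G)))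
    ≡⟨ cong₂ _+ℤ_ (sumℤ-map (allFin (n₁ G)) inj₁ (𝟙 ∘ inVSub G S))
                  (sumℤ-map (allFin (n₂ G)) inj₂ (𝟙 ∘ inVSub G S)) ⟩
  sumℤ (𝟙 ∘ proj₁ S) (allFin (n₁ G)) +ℤ sumℤ (𝟙 ∘ proj₂ S) (allFin (n₂ G))
    ≡⟨ cong₂ _+ℤ_ (count≡sumℤ (proj₁ S) (allFin (n₁ G))) (count≡sumℤ (proj₂ S) (allFin (n₂ G))) ⟨
  + card (proj₁ S) +ℤ + card (proj₂ S)
    ≡⟨ ℤ.pos-+ (card (proj₁ S)) (card (proj₂ S)) ⟨
  + (card (proj₁ S) ℕ.+ card (proj₂ S)) ∎)
  where open ≡-Reasoning

length-allV : ∀ G → length (allV G) ≡ n₁ G ℕ.+ n₂ G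
length-allV G = begin
  length (allV G)
    ≡⟨ length-++ (map inj₁ (allFin (n₁ G))) ⟩
  length (map inj₁ (allFin (n₁ G))) ℕ.+ length (map inj₂ (allFin (n₂ G)))
    ≡⟨ cong₂ ℕ._+_ (length-map inj₁ (allFin (n₁ G))) (length-map inj₂ (allFin (n₂ G))) ⟩
  length (allFin (n₁ G)) ℕ.+ length (allFin (n₂ G))
    ≡⟨ cong₂ ℕ._+_ (length-tabulate {n = n₁ G} (λ i → i)) (length-tabulate {n = n₂ G} (λ j → j)) ⟩
  n₁ G ℕ.+ n₂ G ∎
  where open ≡-Reasoning

≐-dec : ∀ G → Decidable (_≐_ {G})
≐-dec G S S′ =
  map′ (λ (eq₁ , eq₂) → λ { (inj₁ i) → eq₁ i ; (inj₂ j) → eq₂ j }) (λ eq → eq ∘ inj₁ , eq ∘ inj₂)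
    (all? (λ i → proj₁ S i Bool.≟ proj₁ S′ i) ×-dec all? (λ j → proj₂ S j Bool.≟ proj₂ S′ j))

module _ {n : ℕ} (S : Fin n → Bool) where

  ∈-elems⁻ : ∀ {x} → x ∈ elems S → S x ≡ true
  ∈-elems⁻ x∈ = Equivalence.to Bool.T-≡ (proj₂ (∈-filter⁻ (T? ∘ S) {xs = allFin n} x∈))

  ∈-elems⁺ : ∀ {x} → S x ≡ true → x ∈ elems S
  ∈-elems⁺ {x} Sx = ∈-filter⁺ (T? ∘ S) (∈-allFin x) (Equivalence.from Bool.T-≡ Sx)

  elems-unique : Unique (elems S)
  elems-unique = Unique.filter⁺ (T? ∘ S) (Unique.allFin⁺ n)

-- Consistent colourings

module Colouring (Ψ : BipProperty) (Ψ-invariant : IsBipProperty Ψ)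
                 (H G : BipGraph) (c : V G → V H) (c-consistent : ConsistentColouring G H c) where

  open EdgeSubsets H

  c₁ : Fin (n₁ G) → Fin (n₁ H)
  c₁ i = proj₁ (proj₁ (proj₂ c-consistent) i)

  c₂ : Fin (n₂ G) → Fin (n₂ H)
  c₂ j = proj₁ (proj₂ (proj₂ c-consistent) j)

  c-inj₁ : ∀ i → c (inj₁ i) ≡ inj₁ (c₁ i)
  c-inj₁ i = proj₂ (proj₁ (proj₂ c-consistent) i)

  c-inj₂ : ∀ j → c (inj₂ j) ≡ inj₂ (c₂ j)
  c-inj₂ j = proj₂ (proj₂ (proj₂ c-consistent) j)

  c-edge : ∀ {a b} → E G a b ≡ true → E H (c₁ a) (c₂ b) ≡ true
  c-edge {a} {b} Eab =
    subst₂ (λ u v → adj H u v ≡ true) (c-inj₁ a) (c-inj₂ b) (proj₁ c-consistent (inj₁ a) (inj₂ b) Eab)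

  c⁻¹-inj₁ : ∀ {v w} → c v ≡ inj₁ w → ∃[ i ] v ≡ inj₁ i × c₁ i ≡ w
  c⁻¹-inj₁ {inj₁ i} cv≡w = i , refl , inj₁-injective (trans (sym (c-inj₁ i)) cv≡w)
  c⁻¹-inj₁ {inj₂ j} cv≡w with () ← trans (sym (c-inj₂ j)) cv≡w

  c⁻¹-inj₂ : ∀ {v w} → c v ≡ inj₂ w → ∃[ j ] v ≡ inj₂ j × c₂ j ≡ w
  c⁻¹-inj₂ {inj₂ j} cv≡w = j , refl , inj₂-injective (trans (sym (c-inj₂ j)) cv≡w)
  c⁻¹-inj₂ {inj₁ i} cv≡w with () ← trans (sym (c-inj₁ i)) cv≡w

  Prescribed : (V H → V G) → Set
  Prescribed φ = ∀ w → c (φ w) ≡ w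

  prescribedᵇ : (V H → V G) → Bool
  prescribedᵇ = isColPrescribedᵇ G H c

  prescribedᵇ-sound : ∀ {φ} → prescribedᵇ φ ≡ true → Prescribed φ
  prescribedᵇ-sound presc w = eqVᵇ-sound H (allᵇ-sound presc (∈-allV H w))

  prescribedᵇ-complete : ∀ {φ} → Prescribed φ → prescribedᵇ φ ≡ true
  prescribedᵇ-complete {φ} cφ≡id =
    allᵇ-complete {xs = allV H} {p = λ w → eqVᵇ H (c (φ w)) w}
      (λ {w} _ → subst (λ u → eqVᵇ H u w ≡ true) (sym (cφ≡id w)) (eqVᵇ-refl H w))

  -- for prescribed φ, the fixed points of φ ∘ c are exactly the image of φ
  image : (V H → V G) → VSub G
  image φ = (λ i → eqVᵇ G (φ (c (inj₁ i))) (inj₁ i)) , (λ j → eqVᵇ G (φ (c (inj₂ j))) (inj₂ j))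

  ∈-image : ∀ φ v → inVSub G (image φ) v ≡ ⌊ vertex-≟ G (φ (c v)) v ⌋
  ∈-image φ (inj₁ i) = eqVᵇ≡⌊≟⌋ G _ _
  ∈-image φ (inj₂ j) = eqVᵇ≡⌊≟⌋ G _ _

  image-∋ : ∀ {φ} → Prescribed φ → ∀ w → inVSub G (image φ) (φ w) ≡ true
  image-∋ {φ} cφ≡id w = trans (∈-image φ (φ w)) (⌊⌋-complete (vertex-≟ G _ _) (cong φ (cφ≡id w)))

  preservedEdges : (V H → V G) → EdgeSet H
  preservedEdges φ i j = adj G (φ (inj₁ i)) (φ (inj₂ j)) ∧ E H i j

  preservedEdges-⊑ : ∀ φ → preservedEdges φ ⊑ E H ≡ true
  preservedEdges-⊑ φ =
    ⊑-complete {preservedEdges φ} {E H} (λ i j e → proj₂ (∧-true (adj G (φ (inj₁ i)) (φ (inj₂ j))) e))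

  isHomᵇ≡⊑ : ∀ {T} φ → T ⊑ E H ≡ true → isHomᵇ (H [ T ]ᴱ) G φ ≡ T ⊑ preservedEdges φ
  isHomᵇ≡⊑ {T} φ T⊑E = true-equivalent to from
    where
    to : isHomᵇ (H [ T ]ᴱ) G φ ≡ true → T ⊑ preservedEdges φ ≡ true
    to hom = ⊑-complete {T} {preservedEdges φ} λ i j Tij →
      cong₂ _∧_ (⇒ᵇ-sound (allᵇ-sound (allᵇ-sound hom (∈-allV H (inj₁ i))) (∈-allV H (inj₂ j))) Tij)
                (⊑-sound {T} {E H} T⊑E i j Tij)
    from : T ⊑ preservedEdges φ ≡ true → isHomᵇ (H [ T ]ᴱ) G φ ≡ true
    from T⊑P =
      allᵇ-complete {xs = allV H} {p = λ u → allᵇ (allV H) (λ v → adj (H [ T ]ᴱ) u v ⇒ᵇ adj G (φ u) (φ v))}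
        (λ {u} _ → allᵇ-complete {xs = allV H} {p = λ v → adj (H [ T ]ᴱ) u v ⇒ᵇ adj G (φ u) (φ v)}
                     (λ {v} _ → ⇒ᵇ-complete (edge u v)))
      where
      edge₁₂ : ∀ i j → T i j ≡ true → adj G (φ (inj₁ i)) (φ (inj₂ j)) ≡ true
      edge₁₂ i j Tij =
        proj₁ (∧-true (adj G (φ (inj₁ i)) (φ (inj₂ j))) (⊑-sound {T} {preservedEdges φ} T⊑P i j Tij))
      edge : ∀ u v → adj (H [ T ]ᴱ) u v ≡ true → adj G (φ u) (φ v) ≡ true
      edge (inj₁ i) (inj₂ j) Tij = edge₁₂ i j Tij
      edge (inj₂ j) (inj₁ i) Tij = trans (adj-sym G (φ (inj₂ j)) (φ (inj₁ i))) (edge₁₂ i j Tij)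

  f : EdgeSet H → ℤ
  f A = Ψℤ Ψ (H [ A ]ᴱ)

  f-cong : ∀ {A B} → Pointwise _≗_ A B → f A ≡ f B
  f-cong {A} {B} A≐B = cong 𝟙 (Ψ-invariant _ _ (record { σ₁ = ⤖-id _ ; σ₂ = ⤖-id _ ; pres = A≐B }))

  weight : (V H → V G) → ℤ
  weight φ = 𝟙 (prescribedᵇ φ) * f (preservedEdges φ)

  ∈-subsetsOf : ∀ {U T} → T ∈ subsetsOf H U → T ⊑ U ≡ true
  ∈-subsetsOf {U} T∈ = Equivalence.to Bool.T-≡ (proj₂ (∈-filter⁻ (T? ∘ (_⊑ U)) {xs = allEdgeSets H} T∈))

  hom-count-expand : ∀ {T} → T ⊑ E H ≡ true →
    coeff Ψ H T * + #Hom-c H G c T ≡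
    sumℤ (λ φ → 𝟙 (prescribedᵇ φ) * (coeff Ψ H T * 𝟙 (T ⊑ preservedEdges φ))) (allMaps H G)
  hom-count-expand {T} T⊑E = begin
    coeff Ψ H T * + #Hom-c H G c T
      ≡⟨ cong (coeff Ψ H T *_) (count≡sumℤ hom (allMaps H G)) ⟩
    coeff Ψ H T * sumℤ (𝟙 ∘ hom) (allMaps H G)
      ≡⟨ *-distribˡ-sumℤ (allMaps H G) (coeff Ψ H T) (𝟙 ∘ hom) ⟩
    sumℤ (λ φ → coeff Ψ H T * 𝟙 (hom φ)) (allMaps H G)
      ≡⟨ sumℤ-cong (allMaps H G) reorder ⟩
    sumℤ (λ φ → 𝟙 (prescribedᵇ φ) * (coeff Ψ H T * 𝟙 (T ⊑ preservedEdges φ))) (allMaps H G) ∎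
    where
    open ≡-Reasoning
    hom : (V H → V G) → Bool
    hom φ = isHomᵇ (H [ T ]ᴱ) G φ ∧ prescribedᵇ φ
    reorder : ∀ φ → coeff Ψ H T * 𝟙 (hom φ) ≡ 𝟙 (prescribedᵇ φ) * (coeff Ψ H T * 𝟙 (T ⊑ preservedEdges φ))
    reorder φ rewrite isHomᵇ≡⊑ φ T⊑E | 𝟙-∧ (T ⊑ preservedEdges φ) (prescribedᵇ φ) =
      solve 3 (λ k t p → k :* (t :* p) := p :* (k :* t)) refl
        (coeff Ψ H T) (𝟙 (T ⊑ preservedEdges φ)) (𝟙 (prescribedᵇ φ))

  hom-sum : sumℤ (λ T → coeff Ψ H T * + #Hom-c H G c T) (subsetsOf H (E H))
            ≡ sumℤ weight (allMaps H G)
  hom-sum = begin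
    sumℤ (λ T → coeff Ψ H T * + #Hom-c H G c T) subs
      ≡⟨ sumℤ-cong-∈ subs (hom-count-expand ∘ ∈-subsetsOf) ⟩
    sumℤ (λ T → sumℤ (λ φ → term T φ) maps) subs
      ≡⟨ sumℤ-comm subs maps term ⟩
    sumℤ (λ φ → sumℤ (λ T → term T φ) subs) maps
      ≡⟨ sumℤ-cong maps (λ φ → *-distribˡ-sumℤ subs (𝟙 (prescribedᵇ φ)) _) ⟨
    sumℤ (λ φ → 𝟙 (prescribedᵇ φ) * sumℤ (λ T → coeff Ψ H T * 𝟙 (T ⊑ preservedEdges φ)) subs) maps
      ≡⟨ sumℤ-cong maps (λ φ → cong (𝟙 (prescribedᵇ φ) *_)
                                      (möbius-inversion f f-cong (preservedEdges-⊑ φ))) ⟩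
    sumℤ weight maps ∎
    where
    open ≡-Reasoning
    subs : List (EdgeSet H)
    subs = subsetsOf H (E H)
    maps : List (V H → V G)
    maps = allMaps H G
    term : EdgeSet H → (V H → V G) → ℤ
    term T φ = 𝟙 (prescribedᵇ φ) * (coeff Ψ H T * 𝟙 (T ⊑ preservedEdges φ))

  sizeᵇ : VSub G → Bool
  sizeᵇ S = (card (proj₁ S) ℕ.+ card (proj₂ S)) ℕ.≡ᵇ (n₁ H ℕ.+ n₂ H)

  coverᵇ : VSub G → Bool
  coverᵇ S = allᵇ (allV H) (λ w → anyᵇ (allV G) (λ v → inVSub G S v ∧ eqVᵇ H (c v) w))

  sizeᵇ-sound : ∀ {S} → sizeᵇ S ≡ true → count (inVSub G S) (allV G) ≡ length (allV H)
  sizeᵇ-sound {S} size-S =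
    trans (count-allV G S) (trans (ℕ.≡ᵇ⇒≡ _ _ (Equivalence.from Bool.T-≡ size-S)) (sym (length-allV H)))

  sizeᵇ-complete : ∀ {S} → count (inVSub G S) (allV G) ≡ length (allV H) → sizeᵇ S ≡ true
  sizeᵇ-complete {S} count≡ =
    Equivalence.to Bool.T-≡ (ℕ.≡⇒≡ᵇ _ _ (trans (sym (count-allV G S)) (trans count≡ (length-allV H))))

  coverᵇ-sound : ∀ {S} → coverᵇ S ≡ true → ∀ w → ∃[ v ] inVSub G S v ≡ true × c v ≡ w
  coverᵇ-sound {S} cover-S w with anyᵇ-sound (allV G) (allᵇ-sound cover-S (∈-allV H w))
  ... | v , v∈S∧cv≡w with ∧-true (inVSub G S v) v∈S∧cv≡w
  ... | v∈S , cv≡w = v , v∈S , eqVᵇ-sound H cv≡w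

  coverᵇ-complete : ∀ {S} → (∀ w → ∃[ v ] inVSub G S v ≡ true × c v ≡ w) → coverᵇ S ≡ true
  coverᵇ-complete {S} covered =
    allᵇ-complete {xs = allV H} {p = λ w → anyᵇ (allV G) (λ v → inVSub G S v ∧ eqVᵇ H (c v) w)} λ {w} _ →
      let (v , v∈S , cv≡w) = covered w in
      anyᵇ-complete (∈-allV G v)
        (cong₂ _∧_ v∈S (subst (λ u → eqVᵇ H u w ≡ true) (sym cv≡w) (eqVᵇ-refl H w)))

  fixedPoints-count : ∀ {φ} → Prescribed φ →
                      count (λ v → ⌊ vertex-≟ G (φ (c v)) v ⌋) (allV G) ≡ length (allV H)
  fixedPoints-count {φ} = count-fixedPoints-section (vertex-≟ G) (vertex-≟ H)
                            (allV-enumeration G) (allV-enumeration H) c φ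

  image-good : ∀ {S φ} → Prescribed φ → S ≐ image φ → sizeᵇ S ≡ true × coverᵇ S ≡ true
  image-good {S} {φ} cφ≡id S≐image =
    sizeᵇ-complete (trans (count-cong (allV G) (λ v → trans (S≐image v) (∈-image φ v)))
                          (fixedPoints-count cφ≡id)) ,
    coverᵇ-complete (λ w → φ w , trans (S≐image (φ w)) (image-∋ cφ≡id w) , cφ≡id w)

  module GoodSubset (S : VSub G) (size-S : sizeᵇ S ≡ true) (cover-S : coverᵇ S ≡ true) where

    ψ : V H → V G
    ψ w = proj₁ (coverᵇ-sound cover-S w)

    ψ-∈S : ∀ w → inVSub G S (ψ w) ≡ true
    ψ-∈S w = proj₁ (proj₂ (coverᵇ-sound cover-S w))

    ψ-prescribed : Prescribed ψ
    ψ-prescribed w = proj₂ (proj₂ (coverᵇ-sound cover-S w))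

    fixed⇒∈S : ∀ v → ⌊ vertex-≟ G (ψ (c v)) v ⌋ ≡ true → inVSub G S v ≡ true
    fixed⇒∈S v fixed = subst (λ u → inVSub G S u ≡ true) (⌊⌋-sound (vertex-≟ G _ _) fixed) (ψ-∈S (c v))

    -- S contains the image of ψ and has no more elements, so it is that image
    ∈S⇒fixed : ∀ {v} → inVSub G S v ≡ true → ψ (c v) ≡ v
    ∈S⇒fixed {v} v∈S = ⌊⌋-sound (vertex-≟ G _ _)
      (count-mono-≡ (allV G) fixed⇒∈S (trans (fixedPoints-count ψ-prescribed) (sym (sizeᵇ-sound size-S)))
                    (∈-allV G v) v∈S)

    S≐image : S ≐ image ψ
    S≐image v =
      trans (true-equivalent (⌊⌋-complete (vertex-≟ G _ _) ∘ ∈S⇒fixed) (fixed⇒∈S v)) (sym (∈-image ψ v))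

    image-unique : ∀ {φ} → Prescribed φ → S ≐ image φ → φ ≗ ψ
    image-unique {φ} cφ≡id S≐image w =
      trans (sym (∈S⇒fixed (trans (S≐image (φ w)) (image-∋ cφ≡id w)))) (cong ψ (cφ≡id w))

    S-injective : ∀ {v v′} → inVSub G S v ≡ true → inVSub G S v′ ≡ true → c v ≡ c v′ → v ≡ v′
    S-injective v∈S v′∈S cv≡cv′ = trans (sym (∈S⇒fixed v∈S)) (trans (cong ψ cv≡cv′) (∈S⇒fixed v′∈S))

    σ₁ : Fin (length (elems (proj₁ S))) ⤖ Fin (n₁ H)
    σ₁ = lookup-⤖ (elems-unique (proj₁ S)) c₁ injective surjective
      where
      injective : ∀ {x y} → x ∈ elems (proj₁ S) → y ∈ elems (proj₁ S) → c₁ x ≡ c₁ y → x ≡ y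
      injective {x} {y} x∈ y∈ c₁x≡c₁y =
        inj₁-injective (S-injective (∈-elems⁻ (proj₁ S) x∈) (∈-elems⁻ (proj₁ S) y∈)
                                    (trans (c-inj₁ x) (trans (cong inj₁ c₁x≡c₁y) (sym (c-inj₁ y)))))
      surjective : ∀ w → ∃[ x ] x ∈ elems (proj₁ S) × c₁ x ≡ w
      surjective w with c⁻¹-inj₁ (ψ-prescribed (inj₁ w))
      ... | x , ψw≡x , c₁x≡w =
        x , ∈-elems⁺ (proj₁ S) (subst (λ u → inVSub G S u ≡ true) ψw≡x (ψ-∈S (inj₁ w))) , c₁x≡w

    σ₂ : Fin (length (elems (proj₂ S))) ⤖ Fin (n₂ H)
    σ₂ = lookup-⤖ (elems-unique (proj₂ S)) c₂ injective surjective
      where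
      injective : ∀ {x y} → x ∈ elems (proj₂ S) → y ∈ elems (proj₂ S) → c₂ x ≡ c₂ y → x ≡ y
      injective {x} {y} x∈ y∈ c₂x≡c₂y =
        inj₂-injective (S-injective (∈-elems⁻ (proj₂ S) x∈) (∈-elems⁻ (proj₂ S) y∈)
                                    (trans (c-inj₂ x) (trans (cong inj₂ c₂x≡c₂y) (sym (c-inj₂ y)))))
      surjective : ∀ w → ∃[ x ] x ∈ elems (proj₂ S) × c₂ x ≡ w
      surjective w with c⁻¹-inj₂ (ψ-prescribed (inj₂ w))
      ... | x , ψw≡x , c₂x≡w =
        x , ∈-elems⁺ (proj₂ S) (subst (λ u → inVSub G S u ≡ true) ψw≡x (ψ-∈S (inj₂ w))) , c₂x≡w

    edges-preserved : ∀ {a b} → proj₁ S a ≡ true → proj₂ S b ≡ true →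
                      E G a b ≡ preservedEdges ψ (c₁ a) (c₂ b)
    edges-preserved {a} {b} a∈S b∈S = sym (begin
      adj G (ψ (inj₁ (c₁ a))) (ψ (inj₂ (c₂ b))) ∧ E H (c₁ a) (c₂ b)
        ≡⟨ cong₂ (λ u v → adj G u v ∧ E H (c₁ a) (c₂ b)) (ψ-c a∈S (c-inj₁ a)) (ψ-c b∈S (c-inj₂ b)) ⟩
      E G a b ∧ E H (c₁ a) (c₂ b)
        ≡⟨ true-equivalent (proj₁ ∘ ∧-true (E G a b)) (λ Eab → cong₂ _∧_ Eab (c-edge Eab)) ⟩
      E G a b ∎)
      where
      open ≡-Reasoning
      ψ-c : ∀ {v w} → inVSub G S v ≡ true → c v ≡ w → ψ w ≡ v
      ψ-c v∈S refl = ∈S⇒fixed v∈S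

    induced≅preserved : ConsIso (induced G (proj₁ S) (proj₂ S)) (H [ preservedEdges ψ ]ᴱ)
    induced≅preserved = record
      { σ₁ = σ₁
      ; σ₂ = σ₂
      ; pres = λ k l → edges-preserved (∈-elems⁻ (proj₁ S) (∈-lookup k))
                                        (∈-elems⁻ (proj₂ S) (∈-lookup l))
      }

  image-cong : ∀ {φ φ′} → φ ≗ φ′ → image φ ≐ image φ′
  image-cong {φ} {φ′} φ≗φ′ v =
    trans (∈-image φ v) (trans (cong (λ u → ⌊ vertex-≟ G u v ⌋) (φ≗φ′ (c v))) (sym (∈-image φ′ v)))

  prescribed-cong : ∀ {φ φ′} → φ ≗ φ′ → Prescribed φ → Prescribed φ′
  prescribed-cong φ≗φ′ cφ≡id w = trans (cong c (sym (φ≗φ′ w))) (cφ≡id w)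

  weight-cong : ∀ {φ φ′} → φ ≗ φ′ → weight φ ≡ weight φ′
  weight-cong {φ} {φ′} φ≗φ′ = cong₂ _*_
    (cong 𝟙 (true-equivalent (prescribedᵇ-complete ∘ prescribed-cong φ≗φ′ ∘ prescribedᵇ-sound)
                             (prescribedᵇ-complete ∘ prescribed-cong (sym ∘ φ≗φ′) ∘ prescribedᵇ-sound)))
    (f-cong (λ i j → cong₂ (λ u v → adj G u v ∧ E H i j) (φ≗φ′ (inj₁ i)) (φ≗φ′ (inj₂ j))))

  contribution : VSub G → (V H → V G) → ℤ
  contribution S φ = 𝟙 ⌊ ≐-dec G S (image φ) ⌋ * weight φ

  contribution-support : ∀ {S φ} → contribution S φ ≢ + 0 → S ≐ image φ × Prescribed φ
  contribution-support {S} {φ} t≢0 =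
    𝟙⌊⌋-nonzero (≐-dec G S (image φ)) (*-nonzeroˡ _ _ t≢0) ,
    prescribedᵇ-sound (𝟙-nonzero (*-nonzeroˡ _ _ (*-nonzeroʳ (𝟙 ⌊ ≐-dec G S (image φ) ⌋) _ t≢0)))

  contribution-cong : ∀ S {φ φ′} → φ ≗ φ′ → contribution S φ ≡ contribution S φ′
  contribution-cong S {φ} {φ′} φ≗φ′ =
    cong₂ _*_ (cong 𝟙 (⌊⌋-cong (≐-dec G S (image φ)) (≐-dec G S (image φ′))
                                (λ S≐ v → trans (S≐ v) (image-cong φ≗φ′ v))
                                (λ S≐ v → trans (S≐ v) (sym (image-cong φ≗φ′ v)))))
              (weight-cong φ≗φ′)

  contributions-of-map : ∀ φ → sumℤ (λ S → contribution S φ) (allVSub G) ≡ weight φ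
  contributions-of-map φ = begin
    sumℤ (λ S → contribution S φ) (allVSub G)
      ≡⟨ occursOnce-allVSub G (image φ) (λ S → contribution S φ)
                            (λ S → proj₁ ∘ contribution-support) const ⟩
    contribution (image φ) φ
      ≡⟨ cong (_* weight φ) (𝟙⌊⌋-yes (≐-dec G (image φ) (image φ)) (λ _ → refl)) ⟩
    + 1 * weight φ
      ≡⟨ ℤ.*-identityˡ (weight φ) ⟩
    weight φ ∎
    where
    open ≡-Reasoning
    const : ∀ S → S ≐ image φ → contribution S φ ≡ contribution (image φ) φ
    const S S≐image = cong (_* weight φ) (trans (𝟙⌊⌋-yes (≐-dec G S (image φ)) S≐image)
                                                (sym (𝟙⌊⌋-yes (≐-dec G (image φ) (image φ)) (λ _ → refl))))

  no-contributions : ∀ {S} → ¬ (sizeᵇ S ≡ true × coverᵇ S ≡ true) →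
                     sumℤ (contribution S) (allMaps H G) ≡ + 0
  no-contributions {S} not-good = sumℤ-zero (All.universal (λ φ →
    vanishes-off-support {F = contribution S} (λ _ t≢0 → contribution-support t≢0)
                         (λ (S≐image , cφ≡id) → not-good (image-good cφ≡id S≐image)))
    (allMaps H G))

  contributions-to-good-subset : ∀ S → sizeᵇ S ≡ true → coverᵇ S ≡ true →
    sumℤ (contribution S) (allMaps H G) ≡ 𝟙 (Ψ (induced G (proj₁ S) (proj₂ S)))
  contributions-to-good-subset S size-S cover-S = begin
    sumℤ (contribution S) (allMaps H G)
      ≡⟨ occursOnce-allMaps H G ψ (contribution S) supp (λ φ φ≗ψ → contribution-cong S φ≗ψ) ⟩
    contribution S ψ
      ≡⟨ cong₂ (λ a b → a * (b * f (preservedEdges ψ)))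
               (𝟙⌊⌋-yes (≐-dec G S (image ψ)) S≐image) (cong 𝟙 (prescribedᵇ-complete ψ-prescribed)) ⟩
    + 1 * (+ 1 * f (preservedEdges ψ))
      ≡⟨ trans (ℤ.*-identityˡ _) (ℤ.*-identityˡ _) ⟩
    f (preservedEdges ψ)
      ≡⟨ cong 𝟙 (Ψ-invariant _ _ induced≅preserved) ⟨
    𝟙 (Ψ (induced G (proj₁ S) (proj₂ S))) ∎
    where
    open GoodSubset S size-S cover-S
    open ≡-Reasoning
    supp : ∀ φ → contribution S φ ≢ + 0 → φ ≗ ψ
    supp φ t≢0 = let (S≐image , cφ≡id) = contribution-support t≢0 in image-unique cφ≡id S≐image

  contributions-to-subset : ∀ S → sumℤ (contribution S) (allMaps H G) ≡ 𝟙 (isBipIndSubᵇ Ψ G H c S)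
  contributions-to-subset S with sizeᵇ S in size-S | coverᵇ S in cover-S
  ... | false | _     = no-contributions (λ good → case trans (sym size-S) (proj₁ good) of λ ())
  ... | true  | false = no-contributions (λ good → case trans (sym cover-S) (proj₂ good) of λ ())
  ... | true  | true  = contributions-to-good-subset S size-S cover-S

lemma18 : (Ψ : BipProperty) → IsBipProperty Ψ → (H G : BipGraph) →
    (c : V G → V H) → ConsistentColouring G H c →
    + (#BipIndSub Ψ G H c) ≡ sumℤ (λ T → coeff Ψ H T * + (#Hom-c H G c T)) (subsetsOf H (E H))
lemma18 Ψ Ψ-invariant H G c c-consistent = begin
  + #BipIndSub Ψ G H c
    ≡⟨ count≡sumℤ (isBipIndSubᵇ Ψ G H c) (allVSub G) ⟩
  sumℤ (λ S → 𝟙 (isBipIndSubᵇ Ψ G H c S)) (allVSub G)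
    ≡⟨ sumℤ-cong (allVSub G) contributions-to-subset ⟨
  sumℤ (λ S → sumℤ (contribution S) (allMaps H G)) (allVSub G)
    ≡⟨ sumℤ-comm (allVSub G) (allMaps H G) contribution ⟩
  sumℤ (λ φ → sumℤ (λ S → contribution S φ) (allVSub G)) (allMaps H G)
    ≡⟨ sumℤ-cong (allMaps H G) contributions-of-map ⟩
  sumℤ weight (allMaps H G)
    ≡⟨ hom-sum ⟨
  sumℤ (λ T → coeff Ψ H T * + (#Hom-c H G c T)) (subsetsOf H (E H)) ∎
  where
  open Colouring Ψ Ψ-invariant H G c c-consistent
  open ≡-Reasoning
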